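{- Let $k$ be an even positive integer and let $n\ge k$ be an odd integer. Then $g^k(C_{2n})\le 2g^k(C_n)-1$.
   Context: $C_n$ denotes the cyclic group of order $n$. For a finite abelian group $G$ (written additively) and a positive integer $k$, the $k$-Harborth constant $g^k(G)$ is the smallest positive integer $t$ such that every subset $S\subseteq G$ with $|S|\ge t$ contains a subset $T$ with $|T|=k$ and $\sum_{x\in T}x=0$. -}

module Defs where

open import Data.Nat using (ℕ; _≤_; _∸_; _*_)
open import Data.Nat.Divisibility using (_∣_)
open import Data.Fin using (Fin; toℕ)
open import Data.Fin.Subset using (Subset; _∈_; _⊆_; ∣_∣)
open import Data.Fin.Subset.Properties using (_∈?_)
open import Data.List using (List; map; filter; allFin)
open import Data.Nat.ListAction using (sum)
open import Relation.Binary.PropositionalEquality using (_≡_)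
open import Data.Product using (Σ; _×_; ∃-syntax)

-- The cyclic group C_n is modelled as Fin n = {0,…,n-1} with addition mod n.
-- Sum (as a natural number) of the canonical representatives of the
-- elements of a subset S of C_n. Its residue mod n is the group sum.
subsetSum : ∀ {n} → Subset n → ℕ
subsetSum {n} S = sum (map toℕ (filter (_∈? S) (allFin n)))

ZeroSum : ∀ {n} → Subset n → Set
ZeroSum {n} T = n ∣ subsetSum T

HarborthProperty : (n k t : ℕ) → Set
HarborthProperty n k t =
  (S : Subset n) → t ≤ ∣ S ∣ →
  ∃[ T ] (T ⊆ S × ∣ T ∣ ≡ k × ZeroSum T)

IsHarborthConstant : (n k g : ℕ) → Set
IsHarborthConstant n k g =
  (1 ≤ g) × HarborthProperty n k g ×
  ((t : ℕ) → 1 ≤ t → HarborthProperty n k t → g ≤ t)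

{-# OPTIONS --safe #-}
-- Since n is odd, x ↦ x mod n is injective on the even elements of C_{2n} and
-- on its odd elements.  A set S ⊆ C_{2n} with |S| ≥ 2 g^k(C_n) − 1 has at least
-- g^k(C_n) elements of one parity, so their residues contain a k-element
-- zero-sum set T in C_n.  The lift of T back to that parity class sums to 0
-- mod n, and to an even number because it is a sum of an even number k of
-- elements of equal parity; as n is odd, the lift sums to 0 mod 2n.
module Submission where

open import Defs
open import Data.Bool using (Bool; true; false; not; _∧_; _xor_; if_then_else_)
open import Data.Bool.Properties using (not-involutive; not-distribˡ-xor; ∧-zeroʳ; ∧-distribˡ-xor)
open import Data.Fin using (Fin; toℕ; zero; suc)
open import Data.Fin.Subset using (Subset; _⊆_; ∣_∣; inside; outside)
open import Data.Fin.Subset.Properties using (_∈?_; drop-∷-⊆; out⊆; in⊆in)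
open import Data.List using (List; map; filter; allFin; tabulate)
open import Data.List.Properties using (map-∘; map-tabulate)
open import Data.Nat using (ℕ; zero; suc; _+_; _*_; _∸_; _≤_; _<_; _≤?_)
open import Data.Nat.Divisibility using (_∣_; divides; ∣m∣n⇒∣m+n; m∣m*n; *-pres-∣; ∣-refl)
open import Data.Nat.ListAction using (sum)
open import Data.Nat.Primality using (Prime; prime[2]; euclidsLemma)
open import Data.Nat.Properties
open import Algebra.Properties.CommutativeSemigroup +-commutativeSemigroup
  using (interchange; x∙yz≈y∙xz)
open import Data.Product using (_×_; _,_; ∃-syntax; ∃₂)
open import Data.Sum using (_⊎_; inj₁; inj₂; [_,_]′)
open import Data.Vec using ([]; _∷_; _++_; splitAt; here)
open import Relation.Binary.PropositionalEquality
  using (_≡_; refl; sym; trans; cong; cong₂; subst; module ≡-Reasoning)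
open import Relation.Nullary using (¬_; yes; no; does; contradiction)

private
  variable
    m l n : ℕ

parity : ℕ → Bool
parity zero    = false
parity (suc m) = not (parity m)

parity-+ : ∀ m n → parity (m + n) ≡ parity m xor parity n
parity-+ zero    n = refl
parity-+ (suc m) n = trans (cong not (parity-+ m n)) (not-distribˡ-xor (parity m) (parity n))

2∣⇒parity≡false : 2 ∣ m → parity m ≡ false
2∣⇒parity≡false (divides q refl) = parity[q*2] q
  where
  parity[q*2] : ∀ q → parity (q * 2) ≡ false
  parity[q*2] zero    = refl
  parity[q*2] (suc q) = trans (not-involutive _) (parity[q*2] q)

parity≡false⇒2∣ : ∀ m → parity m ≡ false → 2 ∣ m
parity≡false⇒2∣ zero          _  = divides 0 refl
parity≡false⇒2∣ (suc zero)    ()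
parity≡false⇒2∣ (suc (suc m)) eq with parity≡false⇒2∣ m (trans (sym (not-involutive _)) eq)
... | divides q m≡q*2 = divides (suc q) (cong (2 +_) m≡q*2)

¬2∣⇒parity≡true : ¬ 2 ∣ m → parity m ≡ true
¬2∣⇒parity≡true {m} 2∤m with parity m in eq
... | true  = refl
... | false = contradiction (parity≡false⇒2∣ m eq) 2∤m

p∣m∧n∣m⇒p*n∣m : ∀ {p n m} → Prime p → ¬ p ∣ n → p ∣ m → n ∣ m → p * n ∣ m
p∣m∧n∣m⇒p*n∣m {n = n} p-prime p∤n p∣m (divides q refl) with euclidsLemma q n p-prime p∣m
... | inj₁ p∣q = *-pres-∣ p∣q ∣-refl
... | inj₂ p∣n = contradiction p∣n p∤n

∣∷∣ : ∀ b (p : Subset m) → ∣ b ∷ p ∣ ≡ ∣ b ∷ [] ∣ + ∣ p ∣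
∣∷∣ true  p = refl
∣∷∣ false p = refl

∣++∣ : (p : Subset m) (q : Subset l) → ∣ p ++ q ∣ ≡ ∣ p ∣ + ∣ q ∣
∣++∣ []          q = refl
∣++∣ (true ∷ p)  q = cong suc (∣++∣ p q)
∣++∣ (false ∷ p) q = ∣++∣ p q

∷⊆∷ : ∀ {s t} {p q : Subset m} {p′ q′ : Subset l} → s ∷ p ⊆ t ∷ q → p′ ⊆ q′ → s ∷ p′ ⊆ t ∷ q′
∷⊆∷ {s = outside}              _     p′⊆q′ = out⊆ p′⊆q′
∷⊆∷ {s = inside} {t = inside}  _     p′⊆q′ = in⊆in p′⊆q′
∷⊆∷ {s = inside} {t = outside} sp⊆tq _     with sp⊆tq here
... | ()

++-mono-⊆ : {p q : Subset m} {p′ q′ : Subset l} → p ⊆ q → p′ ⊆ q′ → p ++ p′ ⊆ q ++ q′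
++-mono-⊆ {p = []}    {[]}    _   p′⊆q′ = p′⊆q′
++-mono-⊆ {p = _ ∷ _} {_ ∷ _} p⊆q p′⊆q′ = ∷⊆∷ p⊆q (++-mono-⊆ (drop-∷-⊆ p⊆q) p′⊆q′)

infixr 5 _⊕_

_⊕_ : Subset n → Subset n → Subset (2 * n)
L ⊕ R = L ++ (R ++ [])

⊕-split : (S : Subset (2 * n)) → ∃₂ λ L R → S ≡ L ⊕ R
⊕-split {n} S with splitAt n S
... | L , R′ , refl with splitAt n R′
...   | R , [] , refl = L , R , refl

∣⊕∣ : (L R : Subset n) → ∣ L ⊕ R ∣ ≡ ∣ L ∣ + ∣ R ∣
∣⊕∣ L R = trans (∣++∣ L (R ++ [])) (cong (∣ L ∣ +_) (trans (∣++∣ R []) (+-identityʳ ∣ R ∣)))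

⊕-mono-⊆ : {A B L R : Subset n} → A ⊆ L → B ⊆ R → A ⊕ B ⊆ L ⊕ R
⊕-mono-⊆ A⊆L B⊆R = ++-mono-⊆ A⊆L (++-mono-⊆ B⊆R (λ ()))

offsetSum : ℕ → Subset m → ℕ
offsetSum o []      = 0
offsetSum o (b ∷ S) = (if b then o else 0) + offsetSum (suc o) S

subsetSum≡offsetSum : (S : Subset m) → subsetSum S ≡ offsetSum 0 S
subsetSum≡offsetSum S = sum-filter S toℕ 0 (λ _ → refl)
  where
  filter-map-suc : ∀ {m} b (S : Subset m) (xs : List (Fin m)) →
    filter (_∈? (b ∷ S)) (map suc xs) ≡ map suc (filter (_∈? S) xs)
  filter-map-suc b S List.[] = refl
  filter-map-suc b S (x List.∷ xs) with does (x ∈? S)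
  ... | true  = cong (suc x List.∷_) (filter-map-suc b S xs)
  ... | false = filter-map-suc b S xs

  sum-filter : ∀ {m} (S : Subset m) (f : Fin m → ℕ) o → (∀ i → f i ≡ o + toℕ i) →
    sum (map f (filter (_∈? S) (allFin m))) ≡ offsetSum o S

  sum-filter-suc : ∀ {m} b (S : Subset m) (f : Fin (suc m) → ℕ) o → (∀ i → f i ≡ o + toℕ i) →
    sum (map f (filter (_∈? (b ∷ S)) (tabulate suc))) ≡ offsetSum (suc o) S
  sum-filter-suc {m} b S f o f≗ = begin
    sum (map f (filter (_∈? (b ∷ S)) (tabulate suc)))
      ≡⟨ cong (λ xs → sum (map f (filter (_∈? (b ∷ S)) xs))) (map-tabulate (λ i → i) suc) ⟨
    sum (map f (filter (_∈? (b ∷ S)) (map suc (allFin m))))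
      ≡⟨ cong (λ xs → sum (map f xs)) (filter-map-suc b S (allFin m)) ⟩
    sum (map f (map suc (filter (_∈? S) (allFin m))))
      ≡⟨ cong sum (map-∘ (filter (_∈? S) (allFin m))) ⟨
    sum (map (λ i → f (suc i)) (filter (_∈? S) (allFin m)))
      ≡⟨ sum-filter S (λ i → f (suc i)) (suc o) (λ i → trans (f≗ (suc i)) (+-suc o (toℕ i))) ⟩
    offsetSum (suc o) S ∎
    where open ≡-Reasoning

  sum-filter []          f o f≗ = refl
  sum-filter (true ∷ S)  f o f≗ = cong₂ _+_ (trans (f≗ zero) (+-identityʳ o)) (sum-filter-suc true S f o f≗)
  sum-filter (false ∷ S) f o f≗ = sum-filter-suc false S f o f≗

offsetSum-++ : ∀ o (A : Subset m) (B : Subset l) → offsetSum o (A ++ B) ≡ offsetSum o A + offsetSum (o + m) B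
offsetSum-++ o []      B = cong (λ o′ → offsetSum o′ B) (sym (+-identityʳ o))
offsetSum-++ {suc m} o (a ∷ A) B = begin
  (if a then o else 0) + offsetSum (suc o) (A ++ B)
    ≡⟨ cong ((if a then o else 0) +_) (offsetSum-++ (suc o) A B) ⟩
  (if a then o else 0) + (offsetSum (suc o) A + offsetSum (suc o + m) B)
    ≡⟨ +-assoc (if a then o else 0) _ _ ⟨
  offsetSum o (a ∷ A) + offsetSum (suc (o + m)) B
    ≡⟨ cong (λ o′ → offsetSum o (a ∷ A) + offsetSum o′ B) (+-suc o m) ⟨
  offsetSum o (a ∷ A) + offsetSum (o + suc m) B ∎
  where open ≡-Reasoning

offsetSum-⊕ : (L R : Subset n) → offsetSum 0 (L ⊕ R) ≡ offsetSum 0 L + offsetSum n R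
offsetSum-⊕ {n} L R = begin
  offsetSum 0 (L ++ (R ++ []))                       ≡⟨ offsetSum-++ 0 L (R ++ []) ⟩
  offsetSum 0 L + offsetSum n (R ++ [])              ≡⟨ cong (offsetSum 0 L +_) (offsetSum-++ n R []) ⟩
  offsetSum 0 L + (offsetSum n R + 0)                ≡⟨ cong (offsetSum 0 L +_) (+-identityʳ _) ⟩
  offsetSum 0 L + offsetSum n R                      ∎
  where open ≡-Reasoning

offsetSum-+ : ∀ o c (S : Subset m) → offsetSum (o + c) S ≡ offsetSum o S + c * ∣ S ∣
offsetSum-+ o c []          = sym (*-zeroʳ c)
offsetSum-+ o c (false ∷ S) = offsetSum-+ (suc o) c S
offsetSum-+ o c (true ∷ S)  = begin
  (o + c) + offsetSum (suc o + c) S                  ≡⟨ cong ((o + c) +_) (offsetSum-+ (suc o) c S) ⟩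
  (o + c) + (offsetSum (suc o) S + c * ∣ S ∣)        ≡⟨ interchange o c _ _ ⟩
  (o + offsetSum (suc o) S) + (c + c * ∣ S ∣)        ≡⟨ cong ((o + offsetSum (suc o) S) +_) (*-suc c ∣ S ∣) ⟨
  (o + offsetSum (suc o) S) + c * suc ∣ S ∣          ∎
  where open ≡-Reasoning

everyOther : Bool → Subset m → Subset m
everyOther q []      = []
everyOther q (t ∷ T) = (if q then t else outside) ∷ everyOther (not q) T

interleave : Bool → Subset m → Subset m → Subset m
interleave q []      []      = []
interleave q (l ∷ L) (r ∷ R) = (if q then l else r) ∷ interleave (not q) L R

∣everyOther∣ : ∀ q (T : Subset m) → ∣ everyOther q T ∣ + ∣ everyOther (not q) T ∣ ≡ ∣ T ∣
∣everyOther∣ q     []          = refl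
∣everyOther∣ true  (true ∷ T)  = cong suc (∣everyOther∣ false T)
∣everyOther∣ true  (false ∷ T) = ∣everyOther∣ false T
∣everyOther∣ false (true ∷ T)  = trans (+-suc _ _) (cong suc (∣everyOther∣ true T))
∣everyOther∣ false (false ∷ T) = ∣everyOther∣ true T

offsetSum-everyOther : ∀ q o (T : Subset m) →
  offsetSum o (everyOther q T) + offsetSum o (everyOther (not q) T) ≡ offsetSum o T
offsetSum-everyOther q     o []          = refl
offsetSum-everyOther true  o (true ∷ T)  =
  trans (+-assoc o _ _) (cong (o +_) (offsetSum-everyOther false (suc o) T))
offsetSum-everyOther true  o (false ∷ T) = offsetSum-everyOther false (suc o) T
offsetSum-everyOther false o (true ∷ T)  =
  trans (x∙yz≈y∙xz (offsetSum (suc o) (everyOther true T)) o _) (cong (o +_) (offsetSum-everyOther true (suc o) T))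
offsetSum-everyOther false o (false ∷ T) = offsetSum-everyOther true (suc o) T

-- All kept values have the parity of the first kept position (the left conjunct).
parity-offsetSum-everyOther : ∀ q o (T : Subset m) →
  parity (offsetSum o (everyOther q T)) ≡ (if q then parity o else not (parity o)) ∧ parity ∣ everyOther q T ∣
parity-offsetSum-everyOther q     o []          = sym (∧-zeroʳ _)
parity-offsetSum-everyOther false o (t ∷ T)     = parity-offsetSum-everyOther true (suc o) T
parity-offsetSum-everyOther true  o (t ∷ T)     = kept t
  where
  open ≡-Reasoning
  x : Bool
  x = parity ∣ everyOther false T ∣
  Y : ℕ
  Y = offsetSum (suc o) (everyOther false T)

  parity-Y : parity Y ≡ parity o ∧ x
  parity-Y = trans (parity-offsetSum-everyOther false (suc o) T) (cong (_∧ x) (not-involutive (parity o)))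

  xor-∧ : ∀ p y → p xor (p ∧ y) ≡ p ∧ not y
  xor-∧ true  y = refl
  xor-∧ false y = refl

  kept : ∀ t → parity ((if t then o else 0) + Y) ≡ parity o ∧ parity ∣ t ∷ everyOther false T ∣
  kept false = parity-Y
  kept true  = begin
    parity (o + Y)                ≡⟨ parity-+ o Y ⟩
    parity o xor parity Y         ≡⟨ cong (parity o xor_) parity-Y ⟩
    parity o xor (parity o ∧ x)   ≡⟨ xor-∧ (parity o) x ⟩
    parity o ∧ not x              ∎

everyOther-⊆ : ∀ q {T L R : Subset m} → T ⊆ interleave q L R → everyOther q T ⊆ L
everyOther-⊆ q     {[]}    {[]}    {[]}    _   = λ ()
everyOther-⊆ true  {_ ∷ _} {_ ∷ _} {_ ∷ _} T⊆I = ∷⊆∷ T⊆I (everyOther-⊆ false (drop-∷-⊆ T⊆I))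
everyOther-⊆ false {_ ∷ _} {_ ∷ _} {_ ∷ _} T⊆I = out⊆ (everyOther-⊆ true (drop-∷-⊆ T⊆I))

interleave-swap : ∀ q (L R : Subset m) → interleave (not q) R L ≡ interleave q L R
interleave-swap q     []      []      = refl
interleave-swap true  (l ∷ L) (r ∷ R) = cong (l ∷_) (interleave-swap false L R)
interleave-swap false (l ∷ L) (r ∷ R) = cong (r ∷_) (interleave-swap true L R)

∣interleave∣ : (L R : Subset m) → ∣ interleave true L R ∣ + ∣ interleave false L R ∣ ≡ ∣ L ∣ + ∣ R ∣
∣interleave∣ []      []      = refl
∣interleave∣ (l ∷ L) (r ∷ R) = begin
  ∣ l ∷ I₀ ∣ + ∣ r ∷ I₁ ∣          ≡⟨ cong₂ _+_ (∣∷∣ l I₀) (∣∷∣ r I₁) ⟩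
  (a + ∣ I₀ ∣) + (b + ∣ I₁ ∣)      ≡⟨ interchange a _ _ _ ⟩
  (a + b) + (∣ I₀ ∣ + ∣ I₁ ∣)      ≡⟨ cong ((a + b) +_) (+-comm ∣ I₀ ∣ ∣ I₁ ∣) ⟩
  (a + b) + (∣ I₁ ∣ + ∣ I₀ ∣)      ≡⟨ cong ((a + b) +_) (∣interleave∣ L R) ⟩
  (a + b) + (∣ L ∣ + ∣ R ∣)        ≡⟨ interchange a _ _ _ ⟩
  (a + ∣ L ∣) + (b + ∣ R ∣)        ≡⟨ cong₂ _+_ (∣∷∣ l L) (∣∷∣ r R) ⟨
  ∣ l ∷ L ∣ + ∣ r ∷ R ∣            ∎
  where
  open ≡-Reasoning
  I₀ I₁ : Subset _
  I₀ = interleave false L R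
  I₁ = interleave true L R
  a b : ℕ
  a = ∣ l ∷ [] ∣
  b = ∣ r ∷ [] ∣

-- For odd n, lift true T (lift false T) is the set of even (odd) x ∈ C_{2n}
-- with x mod n ∈ T, and interleave q L R is the set of residues mod n of the
-- elements of L ⊕ R in that parity class.
lift : Bool → Subset n → Subset (2 * n)
lift q T = everyOther q T ⊕ everyOther (not q) T

∣lift∣ : ∀ q (T : Subset n) → ∣ lift q T ∣ ≡ ∣ T ∣
∣lift∣ q T = trans (∣⊕∣ (everyOther q T) _) (∣everyOther∣ q T)

lift-⊆ : ∀ q {T L R : Subset n} → T ⊆ interleave q L R → lift q T ⊆ L ⊕ R
lift-⊆ q {T} {L} {R} T⊆I = ⊕-mono-⊆ (everyOther-⊆ q T⊆I) (everyOther-⊆ (not q) T⊆I′)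
  where
  T⊆I′ : T ⊆ interleave (not q) R L
  T⊆I′ = subst (T ⊆_) (sym (interleave-swap q L R)) T⊆I

module _ (q : Bool) (T : Subset n) where
  private
    A B : Subset n
    A = everyOther q T
    B = everyOther (not q) T

  subsetSum-lift : subsetSum (lift q T) ≡ subsetSum T + n * ∣ B ∣
  subsetSum-lift = begin
    subsetSum (lift q T)                          ≡⟨ subsetSum≡offsetSum (lift q T) ⟩
    offsetSum 0 (A ⊕ B)                           ≡⟨ offsetSum-⊕ A B ⟩
    offsetSum 0 A + offsetSum n B                 ≡⟨ cong (offsetSum 0 A +_) (offsetSum-+ 0 n B) ⟩
    offsetSum 0 A + (offsetSum 0 B + n * ∣ B ∣)   ≡⟨ +-assoc (offsetSum 0 A) _ _ ⟨
    offsetSum 0 A + offsetSum 0 B + n * ∣ B ∣     ≡⟨ cong (_+ n * ∣ B ∣) (offsetSum-everyOther q 0 T) ⟩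
    offsetSum 0 T + n * ∣ B ∣                     ≡⟨ cong (_+ n * ∣ B ∣) (subsetSum≡offsetSum T) ⟨
    subsetSum T + n * ∣ B ∣                       ∎
    where open ≡-Reasoning

  parity-subsetSum-lift : parity n ≡ true → parity (subsetSum (lift q T)) ≡ not q ∧ parity ∣ T ∣
  parity-subsetSum-lift n-odd = begin
    parity (subsetSum (lift q T))
      ≡⟨ cong parity (trans (subsetSum≡offsetSum (lift q T)) (offsetSum-⊕ A B)) ⟩
    parity (offsetSum 0 A + offsetSum n B)
      ≡⟨ parity-+ (offsetSum 0 A) _ ⟩
    parity (offsetSum 0 A) xor parity (offsetSum n B)
      ≡⟨ cong₂ _xor_ (parity-offsetSum-everyOther q 0 T) (parity-offsetSum-everyOther (not q) n T) ⟩
    ((if q then false else true) ∧ parity ∣ A ∣)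
      xor ((if not q then parity n else not (parity n)) ∧ parity ∣ B ∣)
      ≡⟨ cong₂ (λ x y → (x ∧ parity ∣ A ∣) xor (y ∧ parity ∣ B ∣)) (first q) (second q) ⟩
    (not q ∧ parity ∣ A ∣) xor (not q ∧ parity ∣ B ∣)
      ≡⟨ ∧-distribˡ-xor (not q) _ _ ⟨
    not q ∧ (parity ∣ A ∣ xor parity ∣ B ∣)
      ≡⟨ cong (not q ∧_) (trans (sym (parity-+ ∣ A ∣ ∣ B ∣)) (cong parity (∣everyOther∣ q T))) ⟩
    not q ∧ parity ∣ T ∣ ∎
    where
    open ≡-Reasoning
    first : ∀ q → (if q then false else true) ≡ not q
    first true  = refl
    first false = refl
    second : ∀ q → (if not q then parity n else not (parity n)) ≡ not q
    second true  = cong not n-odd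
    second false = n-odd

lift-zeroSum : ∀ q {T : Subset n} → ¬ 2 ∣ n → 2 ∣ ∣ T ∣ → ZeroSum T → ZeroSum (lift q T)
lift-zeroSum {n} q {T} 2∤n 2∣∣T∣ n∣ΣT = p∣m∧n∣m⇒p*n∣m prime[2] 2∤n 2∣Σ n∣Σ
  where
  n∣Σ : n ∣ subsetSum (lift q T)
  n∣Σ = subst (n ∣_) (sym (subsetSum-lift q T)) (∣m∣n⇒∣m+n n∣ΣT (m∣m*n _))

  2∣Σ : 2 ∣ subsetSum (lift q T)
  2∣Σ = parity≡false⇒2∣ _ (begin
    parity (subsetSum (lift q T))  ≡⟨ parity-subsetSum-lift q T (¬2∣⇒parity≡true 2∤n) ⟩
    not q ∧ parity ∣ T ∣          ≡⟨ cong (not q ∧_) (2∣⇒parity≡false 2∣∣T∣) ⟩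
    not q ∧ false                  ≡⟨ ∧-zeroʳ (not q) ⟩
    false                          ∎)
    where open ≡-Reasoning

pigeonhole : ∀ g a b → 2 * g ∸ 1 ≤ a + b → g ≤ a ⊎ g ≤ b
pigeonhole g a b 2g∸1≤a+b with g ≤? a | g ≤? b
... | yes g≤a | _       = inj₁ g≤a
... | no _    | yes g≤b = inj₂ g≤b
... | no g≰a  | no g≰b  = contradiction 2g∸1≤a+b (<⇒≱ a+b<2g∸1)
  where
  open ≤-Reasoning
  a+b<2g∸1 : a + b < 2 * g ∸ 1
  a+b<2g∸1 = ∸-monoˡ-≤ 1 (begin
    suc (suc (a + b))  ≡⟨ cong suc (+-suc a b) ⟨
    suc a + suc b      ≤⟨ +-mono-≤ (≰⇒> g≰a) (≤-trans (≰⇒> g≰b) (m≤m+n g 0)) ⟩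
    2 * g              ∎)

zeroSum-from-parityClass : ∀ {k g} → 2 ∣ k → ¬ 2 ∣ n → HarborthProperty n k g →
  ∀ q (L R : Subset n) → g ≤ ∣ interleave q L R ∣ → ∃[ T ] (T ⊆ L ⊕ R × ∣ T ∣ ≡ k × ZeroSum T)
zeroSum-from-parityClass 2∣k 2∤n H q L R g≤∣I∣ with H (interleave q L R) g≤∣I∣
... | T , T⊆I , ∣T∣≡k , T-zero =
  lift q T , lift-⊆ q T⊆I , trans (∣lift∣ q T) ∣T∣≡k ,
  lift-zeroSum q 2∤n (subst (2 ∣_) (sym ∣T∣≡k) 2∣k) T-zero

harborthProperty-double : ∀ {k g} → 2 ∣ k → ¬ 2 ∣ n →
  HarborthProperty n k g → HarborthProperty (2 * n) k (2 * g ∸ 1)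
harborthProperty-double {n} {k} {g} 2∣k 2∤n H S 2g∸1≤∣S∣ with ⊕-split {n} S
... | L , R , refl = [ from-class true , from-class false ]′ (pigeonhole g _ _ 2g∸1≤classes)
  where
  from-class : ∀ q → g ≤ ∣ interleave q L R ∣ → ∃[ T ] (T ⊆ L ⊕ R × ∣ T ∣ ≡ k × ZeroSum T)
  from-class q = zeroSum-from-parityClass 2∣k 2∤n H q L R
  2g∸1≤classes : 2 * g ∸ 1 ≤ ∣ interleave true L R ∣ + ∣ interleave false L R ∣
  2g∸1≤classes = subst (2 * g ∸ 1 ≤_) (trans (∣⊕∣ L R) (sym (∣interleave∣ L R))) 2g∸1≤∣S∣

proposition3p19 : (k n : ℕ) → 1 ≤ k → 2 ∣ k → k ≤ n → ¬ (2 ∣ n) →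
    (g₁ g₂ : ℕ) → IsHarborthConstant n k g₁ → IsHarborthConstant (2 * n) k g₂ →
    g₂ ≤ 2 * g₁ ∸ 1
proposition3p19 k n _ 2∣k _ 2∤n g₁ g₂ (1≤g₁ , H₁ , _) (_ , _ , g₂-least) =
  g₂-least (2 * g₁ ∸ 1) 1≤2g₁∸1 (harborthProperty-double 2∣k 2∤n H₁)
  where
  1≤2g₁∸1 : 1 ≤ 2 * g₁ ∸ 1
  1≤2g₁∸1 = ∸-monoˡ-≤ 1 (+-mono-≤ 1≤g₁ (≤-trans 1≤g₁ (m≤m+n g₁ 0)))
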